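{- Let $p,q,n$ be positive integers, $\alpha\in\mathbb{N}^p$, $\beta\in\mathbb{N}^q$, and let $N\le n$ be a nonnegative integer. Then there exists a nonnegative integer $M$ with $M\geq\max\{|\alpha|,|\beta|\}$ such that $L_N\subset P_M$, where each $\gamma\in L_N$ is regarded as a real $(p+1)\times(q+1)$ matrix.
   Context: For $\alpha\in\mathbb{N}^p$ write $|\alpha|=\sum_{i=1}^p\alpha_i$, similarly $|\beta|$; $[p]=\{1,\dots,p\}$. $L$ is the set of matrices $\gamma=(\gamma_{ij})$, $i\in\{0,\dots,p\}$, $j\in\{0,\dots,q\}$, with entries in $\mathbb{N}$ such that $\gamma_{00}=0$, $|\gamma|:=\sum_{i,j}\gamma_{ij}\leq n$, $\sum_{j=0}^{q}\gamma_{ij}=\alpha_i$ for $i\in[p]$, and $\sum_{i=0}^{p}\gamma_{ij}=\beta_j$ for $j\in[q]$. $L_N=\{\gamma\in L:|\gamma|=N\}$. For an integer $M\ge\max\{|\alpha|,|\beta|\}$, set $\alpha_0=M-|\alpha|$, $\beta_0=M-|\beta|$, $\overline{\alpha}=(\alpha_0,\alpha_1,\dots,\alpha_p)$, $\overline{\beta}=(\beta_0,\beta_1,\dots,\beta_q)$; the transportation polytope $P_M$ is the set of real matrices $x=(x_{ij})$, $i\in\{0,\dots,p\}$, $j\in\{0,\dots,q\}$, with $x_{ij}\ge0$, $\sum_{j=0}^q x_{ij}=\overline{\alpha}_i$ for all $i\in\{0,\dots,p\}$ and $\sum_{i=0}^p x_{ij}=\overline{\beta}_j$ for all $j\in\{0,\dots,q\}$.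 -}

module Defs where

open import Data.Nat using (ℕ; zero; suc; _+_; _∸_; _≤_)
open import Data.Fin using (Fin; zero; suc)
open import Data.Product using (_×_)
open import Relation.Binary.PropositionalEquality using (_≡_)

sumF : ∀ {k} → (Fin k → ℕ) → ℕ
sumF {zero}  f = 0
sumF {suc k} f = f zero + sumF (λ i → f (suc i))

-- a (p+1)×(q+1) matrix with entries in ℕ; row/column index 0 is Fin.zero,
-- index i ∈ [p] is Fin.suc i (with i : Fin p, i.e. 0-based shift)
Mat : ℕ → ℕ → Set
Mat p q = Fin (suc p) → Fin (suc q) → ℕ

rowSum : ∀ {p q} → Mat p q → Fin (suc p) → ℕ
rowSum γ i = sumF (λ j → γ i j)

colSum : ∀ {p q} → Mat p q → Fin (suc q) → ℕ
colSum γ j = sumF (λ i → γ i j)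

total : ∀ {p q} → Mat p q → ℕ
total γ = sumF (λ i → rowSum γ i)

record InL {p q : ℕ} (n : ℕ) (α : Fin p → ℕ) (β : Fin q → ℕ) (γ : Mat p q) : Set where
  field
    corner : γ zero zero ≡ 0
    bound  : total γ ≤ n
    rows   : (i : Fin p) → rowSum γ (suc i) ≡ α i
    cols   : (j : Fin q) → colSum γ (suc j) ≡ β j

InLN : {p q : ℕ} (n : ℕ) (α : Fin p → ℕ) (β : Fin q → ℕ) (N : ℕ) → Mat p q → Set
InLN n α β N γ = InL n α β γ × total γ ≡ N

extend : ∀ {p} → ℕ → (Fin p → ℕ) → Fin (suc p) → ℕ
extend M α zero    = M ∸ sumF α
extend M α (suc i) = α i

-- Nonnegativity x_ij ≥ 0 is automatic for ℕ entries; the margin equations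
-- between naturals hold in ℝ iff they hold in ℕ.  Used only when M ≥ |α|, |β|
-- so that ∸ is true subtraction.
record InP {p q : ℕ} (α : Fin p → ℕ) (β : Fin q → ℕ) (M : ℕ) (γ : Mat p q) : Set where
  field
    rowMargins : (i : Fin (suc p)) → rowSum γ i ≡ extend M α i
    colMargins : (j : Fin (suc q)) → colSum γ j ≡ extend M β j

module Submission where

-- Every γ ∈ L already satisfies the margins of P_M for M = |γ|: its row sums
-- over [p] are α and they add up to |γ|, so row 0 sums to |γ| − |α|, and
-- likewise for the columns.  In particular |α|, |β| ≤ |γ|, so when L_N is
-- nonempty M = max {N, |α|, |β|} equals N and works; when L_N is empty any
-- M ≥ |α|, |β| does.

open import Defs
open import Data.Nat using (ℕ; zero; suc; _+_; _∸_; _≤_; _⊔_)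
open import Data.Nat.Properties
  using ( +-commutativeSemigroup; m+n∸n≡m; m≤n+m; m≤m⊔n; m≤n⊔m; ≤-trans
        ; ⊔-lub; m≥n⇒m⊔n≡m )
open import Algebra.Properties.CommutativeSemigroup +-commutativeSemigroup using (interchange)
open import Data.Fin using (Fin; zero; suc)
open import Data.Product using (_×_; ∃-syntax; _,_)
open import Relation.Binary.PropositionalEquality
  using (_≡_; refl; sym; trans; cong; cong₂; subst; module ≡-Reasoning)

sumF-cong : ∀ {k} {f g : Fin k → ℕ} → (∀ i → f i ≡ g i) → sumF f ≡ sumF g
sumF-cong {zero}  f≗g = refl
sumF-cong {suc k} f≗g = cong₂ _+_ (f≗g zero) (sumF-cong (λ i → f≗g (suc i)))

sumF-zero : ∀ k → sumF {k} (λ _ → 0) ≡ 0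
sumF-zero zero    = refl
sumF-zero (suc k) = sumF-zero k

sumF-+ : ∀ {k} (f g : Fin k → ℕ) → sumF (λ i → f i + g i) ≡ sumF f + sumF g
sumF-+ {zero}  f g = refl
sumF-+ {suc k} f g = begin
  f zero + g zero + sumF (λ i → f (suc i) + g (suc i))
    ≡⟨ cong (f zero + g zero +_) (sumF-+ (λ i → f (suc i)) (λ i → g (suc i))) ⟩
  f zero + g zero + (sumF (λ i → f (suc i)) + sumF (λ i → g (suc i)))
    ≡⟨ interchange (f zero) (g zero) _ _ ⟩
  sumF f + sumF g ∎
  where open ≡-Reasoning

sumF-comm : ∀ {a b} (f : Fin a → Fin b → ℕ) →
  sumF (λ i → sumF (λ j → f i j)) ≡ sumF (λ j → sumF (λ i → f i j))
sumF-comm {zero}  {b} f = sym (sumF-zero b)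
sumF-comm {suc a}     f = begin
  sumF (λ j → f zero j) + sumF (λ i → sumF (λ j → f (suc i) j))
    ≡⟨ cong (sumF (λ j → f zero j) +_) (sumF-comm (λ i → f (suc i))) ⟩
  sumF (λ j → f zero j) + sumF (λ j → sumF (λ i → f (suc i) j))
    ≡⟨ sym (sumF-+ (λ j → f zero j) (λ j → sumF (λ i → f (suc i) j))) ⟩
  sumF (λ j → sumF (λ i → f i j)) ∎
  where open ≡-Reasoning

total≡sumF-colSum : ∀ {p q} (γ : Mat p q) → total γ ≡ sumF (colSum γ)
total≡sumF-colSum = sumF-comm

module _ {p q n : ℕ} {α : Fin p → ℕ} {β : Fin q → ℕ} {γ : Mat p q}
         (γ∈L : InL n α β γ) where
  open InL γ∈L

  total≡rowSum₀+sumα : total γ ≡ rowSum γ zero + sumF α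
  total≡rowSum₀+sumα = cong (rowSum γ zero +_) (sumF-cong rows)

  total≡colSum₀+sumβ : total γ ≡ colSum γ zero + sumF β
  total≡colSum₀+sumβ =
    trans (total≡sumF-colSum γ) (cong (colSum γ zero +_) (sumF-cong cols))

  sumα≤total : sumF α ≤ total γ
  sumα≤total = subst (sumF α ≤_) (sym total≡rowSum₀+sumα) (m≤n+m _ _)

  sumβ≤total : sumF β ≤ total γ
  sumβ≤total = subst (sumF β ≤_) (sym total≡colSum₀+sumβ) (m≤n+m _ _)

  InL⇒InP-total : InP α β (total γ) γ
  InL⇒InP-total = record { rowMargins = rowMargins ; colMargins = colMargins }
    where
    rowMargins : (i : Fin (suc p)) → rowSum γ i ≡ extend (total γ) α i
    rowMargins zero    =
      sym (trans (cong (_∸ sumF α) total≡rowSum₀+sumα) (m+n∸n≡m _ (sumF α)))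
    rowMargins (suc i) = rows i

    colMargins : (j : Fin (suc q)) → colSum γ j ≡ extend (total γ) β j
    colMargins zero    =
      sym (trans (cong (_∸ sumF β) total≡colSum₀+sumβ) (m+n∸n≡m _ (sumF β)))
    colMargins (suc j) = cols j

theorem3p6 : (p q n : ℕ) → 1 ≤ p → 1 ≤ q → 1 ≤ n →
    (α : Fin p → ℕ) (β : Fin q → ℕ) (N : ℕ) → N ≤ n →
    ∃[ M ] (sumF α ≤ M × sumF β ≤ M ×
      ((γ : Mat p q) → InLN n α β N γ → InP α β M γ))
theorem3p6 p q n _ _ _ α β N _ = M , sumα≤M , sumβ≤M , LN⊆PM
  where
  M : ℕ
  M = N ⊔ (sumF α ⊔ sumF β)

  sumα≤M : sumF α ≤ M
  sumα≤M = ≤-trans (m≤m⊔n (sumF α) (sumF β)) (m≤n⊔m N _)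

  sumβ≤M : sumF β ≤ M
  sumβ≤M = ≤-trans (m≤n⊔m (sumF α) (sumF β)) (m≤n⊔m N _)

  LN⊆PM : (γ : Mat p q) → InLN n α β N γ → InP α β M γ
  LN⊆PM γ (γ∈L , refl) =
    subst (λ M → InP α β M γ) (sym M≡total) (InL⇒InP-total γ∈L)
    where
    M≡total : M ≡ total γ
    M≡total = m≥n⇒m⊔n≡m (⊔-lub (sumα≤total γ∈L) (sumβ≤total γ∈L))
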